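{- For any $1 \le k < n$, suppose that $\mathbb{Z}_k$ is a $1$-Gray code for $\mathcal{Z}_k$ with $\mathrm{first}(\mathbb{Z}_k)=0(001)^\star$ and $\mathrm{last}(\mathbb{Z}_k)=(001)^\star$. Given $i$ and $j$ such that $1\leq j<i\leq n$, then ($i$) for $3 \leq i+j<n$, the list $\mathbb{L}=0^i1^j \cdot \mathbb{Z}_{n-i-j}$ is a $1$-Gray code for $0^i1^j \cdot \mathcal{Z}_{n-i-j}$ with $\mathrm{first}(\mathbb{L})=0^i1^j0(001)^\star$ and $\mathrm{last}(\mathbb{L})=0^i1^j(001)^\star$; when $i+j = n$ the list $\mathbb{L}$ contains only the word $0^i1^j$; ($ii$) for $3 \leq i + j < n-1$, the list $\mathbb{L}=0^i1^{j+1} \cdot \mathbb{Z}_{n-i-j-1}\circ 0^i1^{j} \cdot \mathbb{Z}_{n-i-j}$ is a $1$-Gray code for $0^i1^{j+1} \cdot \mathcal{Z}_{n-i-j-1} \cup 0^i1^j \cdot \mathcal{Z}_{n-i-j}$ with $\mathrm{first}( \mathbb{L})=0^i1^{j+1}0(001)^\star$ and $\mathrm{last}(\mathbb{L})=0^i1^{j}(001)^\star$; when $i+j +1 = n$, the list $\mathbb{L} = 0^i1^{j+1} \circ 0^i1^j0$; ($iii$) for $3 \leq i + j < n$, the list $\mathbb{L}=0^i1^{j} \cdot \mathbb{Z}_{n-i-j}\circ \overline{0^{i-1}1^{j+1} \cdot \mathbb{Z}_{n-i-j}}$ is a $1$-Gray code for $0^i1^j \cdot \mathcal{Z}_{n-i-j}\cup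 0^{i-1}1^{j+1} \cdot \mathcal{Z}_{n-i-j}$ with $\mathrm{first}( \mathbb{L})=0^i1^{j}0(001)^\star$ and $\mathrm{last}(\mathbb{L})=0^{i-1}1^{j+1}0(001)^\star$; when $i + j = n$, the list $\mathbb{L} = 0^i1^j \circ 0^{i-1}1^{j+1}$; ($iv$) for $3 \leq i + j \le n$, the list $\mathbb{L}=\overline{0^i1^{j} \cdot \mathbb{Z}_{n-i-j}}\circ 0^{i-1}1^{j+1} \cdot \mathbb{Z}_{n-i-j}$ is a $1$-Gray code for $0^i1^j \cdot \mathcal{Z}_{n-i-j}\cup 0^{i-1}1^{j+1} \cdot \mathcal{Z}_{n-i-j}$ with $\mathrm{first}( \mathbb{L})=0^i1^{j}(001)^\star$ and $\mathrm{last}(\mathbb{L})=0^{i-1}1^{j+1}(001)^\star$.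
   Context: A binary word is $1$-decreasing if each of its maximal factors of the form $0^a1^b$ with $a>0$ satisfies $a>b$. $\mathcal{Z}_n$ denotes the set of $1$-decreasing words of length $n$ that start with $0$ (with $\mathcal{Z}_0$ consisting of the empty word $\epsilon$). A $1$-Gray code for a set of words is an ordered list of all its words such that any two consecutive words have Hamming distance at most one. For lists: $\circ$ denotes concatenation of lists; $w\cdot\mathbb{L}$ is the list obtained by prepending the word $w$ to every word of $\mathbb{L}$; $\overline{\mathbb{L}}$ is the reverse of the list $\mathbb{L}$; $\mathrm{first}(\mathbb{L})$ and $\mathrm{last}(\mathbb{L})$ are the first and last elements of $\mathbb{L}$. For a word $v$, $v^\star$ means $v$ repeated as many times as needed to reach the (contextually understood) total length, trimming extra symbols at the end; e.g. a length-7 word equal to $(001)^\star$ is $0010010$. Initial lists: $\mathbb{Z}_0=\epsilon$, $\mathbb{Z}_1=0$, $\mathbb{Z}_2=00$, $\mathbb{Z}_3=000\circ 001$. -}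

module Defs where

open import Data.Bool using (Bool; true; false)
open import Data.Nat using (ℕ; zero; suc; _+_; _≤_; _<_)
open import Data.List using (List; []; _∷_; _++_; replicate; take; concat; length; head; last; map; reverse)
open import Data.Maybe using (Maybe; just; nothing)
open import Data.Product using (Σ; _×_; ∃; _,_)
open import Data.Sum using (_⊎_)
open import Relation.Binary.PropositionalEquality using (_≡_; _≢_)
open import Relation.Nullary using (¬_)
open import Data.List.Membership.Propositional using (_∈_)
open import Data.List.Relation.Unary.Unique.Propositional using (Unique)
open import Data.List.Relation.Unary.Linked using (Linked)

Word : Set
Word = List Bool

O I : Bool
O = false
I = true

0^_1^_ : ℕ → ℕ → Word
0^ a 1^ b = replicate a O ++ replicate b I

-- v^⋆ truncated to total length m (v repeated enough times, then trimmed)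
star : Word → ℕ → Word
star v m = take m (concat (replicate m v))

p001 : ℕ → Word
p001 m = star (O ∷ O ∷ I ∷ []) m

-- 0^a 1^b (a > 0) occurs as a maximal factor of w at the split w = u ++ 0^a1^b ++ v:
-- it cannot be extended to the left by a 0, nor to the right (by a 1, or by anything
-- when b = 0, since then both a 0 or a 1 would extend it).
MaximalFactor : Word → Word → ℕ → ℕ → Word → Set
MaximalFactor w u a b v =
  (w ≡ u ++ 0^ a 1^ b ++ v) × (0 < a) ×
  (∀ u' → u ≢ u' ++ (O ∷ [])) ×
  (∀ v' → v ≢ I ∷ v') ×
  (b ≡ 0 → v ≡ [])

OneDecreasing : Word → Set
OneDecreasing w = ∀ u a b v → MaximalFactor w u a b v → b < a

-- membership in 𝒵_n : 1-decreasing words of length n starting with 0 (𝒵_0 = {ε})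
InZ : ℕ → Word → Set
InZ n w = (length w ≡ n) × ((n ≡ 0) ⊎ (head w ≡ just O)) × OneDecreasing w

-- Hamming distance (mismatched positions; any length difference also counted)
ham : Word → Word → ℕ
ham [] v = length v
ham (x ∷ u) [] = length (x ∷ u)
ham (false ∷ u) (false ∷ v) = ham u v
ham (true ∷ u) (true ∷ v) = ham u v
ham (false ∷ u) (true ∷ v) = suc (ham u v)
ham (true ∷ u) (false ∷ v) = suc (ham u v)

record IsGray (S : Word → Set) (L : List Word) : Set where
  field
    complete : ∀ w → S w → w ∈ L
    sound    : ∀ w → w ∈ L → S w
    unique   : Unique L
    adjacent : Linked (λ u v → ham u v ≤ 1) L

_·_ : Word → List Word → List Word
w · L = map (w ++_) L

PrefZ : Word → ℕ → Word → Set
PrefZ w m x = Σ Word (λ y → InZ m y × (x ≡ w ++ y))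

_∪_ : (Word → Set) → (Word → Set) → Word → Set
(S ∪ T) x = S x ⊎ T x

GoodZ : ℕ → List Word → Set
GoodZ k L = IsGray (InZ k) L × (head L ≡ just (O ∷ p001 (k Data.Nat.∸ 1))) × (last L ≡ just (p001 k))

-- The concatenations are Gray
-- codes because the two prefixed sets are disjoint and the words meeting at the junction differ
-- in one letter: 0^{a+1}1^j p and 0^a1^{j+1} p differ at position a+1, and 0^i1^{j+1}p and
-- 0^i1^j0p at position i+j+1.

module Submission where

open import Defs
open import Data.Bool using (false; true)
open import Data.Empty using (⊥-elim)
open import Data.List using (List; []; _∷_; _++_; head; last; reverse; [_]; replicate)
open import Data.List.Properties
  using (++-assoc; ++-cancelˡ; ++-identityʳ; ∷-injectiveˡ; unfold-reverse; reverse-involutive; head-map; last-map)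
open import Data.List.Membership.Propositional.Properties using (∈-map⁺; ∈-map⁻; ∈-++⁺ˡ; ∈-++⁺ʳ; ∈-++⁻)
open import Data.List.Relation.Unary.All using (lookup)
open import Data.List.Relation.Unary.AllPairs using ([]; _∷_)
open import Data.List.Relation.Unary.Any using (here; there)
open import Data.List.Relation.Unary.Any.Properties using (reverse⁺; reverse⁻)
open import Data.List.Relation.Unary.Linked using (Linked; []; [-])
import Data.List.Relation.Unary.Linked as Linked
import Data.List.Relation.Unary.Linked.Properties as Linked
open import Data.List.Relation.Unary.Unique.Propositional using (Unique)
import Data.List.Relation.Unary.Unique.Propositional.Properties as Unique
open import Data.Maybe using (just)
import Data.Maybe as Maybe
open import Data.Maybe.Relation.Binary.Connected using (Connected; just)
import Data.Maybe.Relation.Binary.Connected as Connected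
open import Data.Nat using (ℕ; zero; suc; _+_; _∸_; _≤_; _<_; z≤n; s≤s)
open import Data.Nat.Properties using (≤-refl; <⇒≤; m<n⇒0<n∸m; ∸-monoʳ-<; ∸-+-assoc; +-comm; n∸n≡0; m+n∸n≡m)
open import Data.Product using (Σ; _×_; _,_)
open import Data.Sum using (inj₁; inj₂)
import Data.Sum as Sum
open import Function using (_∘_)
open import Relation.Binary.Definitions using (Symmetric)
open import Relation.Binary.PropositionalEquality using (_≡_; _≢_; refl; sym; trans; cong; cong₂; subst; module ≡-Reasoning)
open import Relation.Unary using (_⊥_)

private variable
  A : Set

Adjacent : Word → Word → Set
Adjacent u v = ham u v ≤ 1

GrayFromTo : (Word → Set) → List Word → Word → Word → Set
GrayFromTo S L f l = IsGray S L × head L ≡ just f × last L ≡ just l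

ham-refl : ∀ u → ham u u ≡ 0
ham-refl []          = refl
ham-refl (false ∷ u) = ham-refl u
ham-refl (true ∷ u)  = ham-refl u

ham-sym : ∀ u v → ham u v ≡ ham v u
ham-sym []          []          = refl
ham-sym []          (_ ∷ _)     = refl
ham-sym (_ ∷ _)     []          = refl
ham-sym (false ∷ u) (false ∷ v) = ham-sym u v
ham-sym (false ∷ u) (true ∷ v)  = cong suc (ham-sym u v)
ham-sym (true ∷ u)  (false ∷ v) = cong suc (ham-sym u v)
ham-sym (true ∷ u)  (true ∷ v)  = ham-sym u v

ham-++ˡ : ∀ w u v → ham (w ++ u) (w ++ v) ≡ ham u v
ham-++ˡ []          u v = refl
ham-++ˡ (false ∷ w) u v = ham-++ˡ w u v
ham-++ˡ (true ∷ w)  u v = ham-++ˡ w u v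

Adjacent-sym : Symmetric Adjacent
Adjacent-sym {u} {v} = subst (_≤ 1) (ham-sym u v)

Adjacent-∷ : ∀ x y p → Adjacent (x ∷ p) (y ∷ p)
Adjacent-∷ false false p rewrite ham-refl p = z≤n
Adjacent-∷ false true  p rewrite ham-refl p = ≤-refl
Adjacent-∷ true  false p rewrite ham-refl p = ≤-refl
Adjacent-∷ true  true  p rewrite ham-refl p = z≤n

Adjacent-++ˡ : ∀ w {u v} → Adjacent u v → Adjacent (w ++ u) (w ++ v)
Adjacent-++ˡ w {u} {v} = subst (_≤ 1) (sym (ham-++ˡ w u v))

++-∷-≢ : ∀ (u : List A) {x y} p q → x ≢ y → u ++ x ∷ p ≢ u ++ y ∷ q
++-∷-≢ u p q x≢y = x≢y ∘ ∷-injectiveˡ ∘ ++-cancelˡ u _ _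

last-∷ : ∀ (x : A) xs {y} → last xs ≡ just y → last (x ∷ xs) ≡ just y
last-∷ x (_ ∷ _) e = e

head-++ : ∀ (xs ys : List A) {x} → head xs ≡ just x → head (xs ++ ys) ≡ just x
head-++ (_ ∷ _) ys e = e

last-++ : ∀ (xs ys : List A) {y} → last ys ≡ just y → last (xs ++ ys) ≡ just y
last-++ []       ys e = e
last-++ (x ∷ xs) ys e = last-∷ x (xs ++ ys) (last-++ xs ys e)

last-reverse : ∀ (xs : List A) → last (reverse xs) ≡ head xs
last-reverse []       = refl
last-reverse (x ∷ xs) rewrite unfold-reverse x xs = last-++ (reverse xs) [ x ] refl

head-reverse : ∀ (xs : List A) → head (reverse xs) ≡ last xs
head-reverse xs = trans (sym (last-reverse (reverse xs))) (cong last (reverse-involutive xs))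

Linked-reverse : ∀ {R : A → A → Set} → Symmetric R → ∀ {xs} → Linked R xs → Linked R (reverse xs)
Linked-reverse R-sym {[]}     []  = []
Linked-reverse {R = R} R-sym {x ∷ xs} Rxxs rewrite unfold-reverse x xs =
  Linked.++⁺ (Linked-reverse R-sym (Linked.tail Rxxs))
             (subst (λ m → Connected R m (just x)) (sym (last-reverse xs))
                    (Connected.sym R-sym (Linked.head′ Rxxs)))
             [-]

Unique-reverse : ∀ {xs : List A} → Unique xs → Unique (reverse xs)
Unique-reverse {xs = []}     []         = []
Unique-reverse {xs = x ∷ xs} (x∉ ∷ uxs) rewrite unfold-reverse x xs =
  Unique.++⁺ (Unique-reverse uxs) (Data.List.Relation.Unary.All.[] ∷ [])
             λ { (x∈ , here refl) → lookup x∉ (reverse⁻ x∈) refl }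

prefix-gray : ∀ w {S L f l} → GrayFromTo S L f l →
              GrayFromTo (λ x → Σ Word λ y → S y × x ≡ w ++ y) (w · L) (w ++ f) (w ++ l)
prefix-gray w {L = L} (g , first , final) =
  record
    { complete = λ { _ (y , Sy , refl) → ∈-map⁺ (w ++_) (IsGray.complete g y Sy) }
    ; sound    = λ x x∈ → let y , y∈ , x≡ = ∈-map⁻ (w ++_) x∈ in y , IsGray.sound g y y∈ , x≡
    ; unique   = Unique.map⁺ (++-cancelˡ w _ _) (IsGray.unique g)
    ; adjacent = Linked.map⁺ (Linked.map (Adjacent-++ˡ w) (IsGray.adjacent g))
    }
  , trans (head-map L) (cong (Maybe.map (w ++_)) first)
  , trans (last-map (w ++_) L) (cong (Maybe.map (w ++_)) final)

reverse-gray : ∀ {S L f l} → GrayFromTo S L f l → GrayFromTo S (reverse L) l f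
reverse-gray {L = L} (g , first , final) =
  record
    { complete = λ w → reverse⁺ ∘ IsGray.complete g w
    ; sound    = λ w → IsGray.sound g w ∘ reverse⁻
    ; unique   = Unique-reverse (IsGray.unique g)
    ; adjacent = Linked-reverse (λ {u} {v} → Adjacent-sym {u} {v}) (IsGray.adjacent g)
    }
  , trans (head-reverse L) final
  , trans (last-reverse L) first

++-gray : ∀ {S T L₁ L₂ f₁ l₁ f₂ l₂} → GrayFromTo S L₁ f₁ l₁ → GrayFromTo T L₂ f₂ l₂ →
          S ⊥ T → Adjacent l₁ f₂ → GrayFromTo (S ∪ T) (L₁ ++ L₂) f₁ l₂
++-gray {L₁ = L₁} {L₂} {l₁ = l₁} {f₂} (g₁ , first₁ , final₁) (g₂ , first₂ , final₂) S⊥T l₁~f₂ =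
  record
    { complete = λ { w (inj₁ s) → ∈-++⁺ˡ (IsGray.complete g₁ w s)
                   ; w (inj₂ t) → ∈-++⁺ʳ L₁ (IsGray.complete g₂ w t) }
    ; sound    = λ w → Sum.map (IsGray.sound g₁ w) (IsGray.sound g₂ w) ∘ ∈-++⁻ L₁
    ; unique   = Unique.++⁺ (IsGray.unique g₁) (IsGray.unique g₂)
                   λ { (w∈₁ , w∈₂) → S⊥T (IsGray.sound g₁ _ w∈₁ , IsGray.sound g₂ _ w∈₂) }
    ; adjacent = Linked.++⁺ (IsGray.adjacent g₁) (connect final₁ first₂) (IsGray.adjacent g₂)
    }
  , head-++ L₁ L₂ first₁
  , last-++ L₁ L₂ final₂
  where
    connect : ∀ {m m'} → m ≡ just l₁ → m' ≡ just f₂ → Connected Adjacent m m'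
    connect refl refl = just l₁~f₂

∷-replicate : ∀ n (x : A) q → x ∷ replicate n x ++ q ≡ replicate n x ++ x ∷ q
∷-replicate zero    x q = refl
∷-replicate (suc n) x q = cong (x ∷_) (∷-replicate n x q)

0^suc1^-++ : ∀ a j p → 0^ suc a 1^ j ++ p ≡ replicate a O ++ O ∷ replicate j I ++ p
0^suc1^-++ a j p = trans (++-assoc (O ∷ replicate a O) (replicate j I) p) (∷-replicate a O _)

0^1^suc-++ : ∀ a j p → 0^ a 1^ suc j ++ p ≡ replicate a O ++ I ∷ replicate j I ++ p
0^1^suc-++ a j p = ++-assoc (replicate a O) (I ∷ replicate j I) p

0^1^suc-++-∷ : ∀ i j p → 0^ i 1^ suc j ++ p ≡ 0^ i 1^ j ++ I ∷ p
0^1^suc-++-∷ i j p = begin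
  (replicate i O ++ I ∷ replicate j I) ++ p ≡⟨ ++-assoc (replicate i O) _ p ⟩
  replicate i O ++ I ∷ replicate j I ++ p   ≡⟨ cong (replicate i O ++_) (∷-replicate j I p) ⟩
  replicate i O ++ replicate j I ++ I ∷ p   ≡⟨ ++-assoc (replicate i O) (replicate j I) (I ∷ p) ⟨
  (replicate i O ++ replicate j I) ++ I ∷ p ∎
  where open ≡-Reasoning

shift-adjacent : ∀ a j p → Adjacent (0^ suc a 1^ j ++ p) (0^ a 1^ suc j ++ p)
shift-adjacent a j p rewrite 0^suc1^-++ a j p | 0^1^suc-++ a j p =
  Adjacent-++ˡ (replicate a O) (Adjacent-∷ O I (replicate j I ++ p))

extend-adjacent : ∀ i j p → Adjacent (0^ i 1^ suc j ++ p) (0^ i 1^ j ++ O ∷ p)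
extend-adjacent i j p rewrite 0^1^suc-++-∷ i j p = Adjacent-++ˡ (0^ i 1^ j) (Adjacent-∷ I O p)

InZ-∷ : ∀ {m y} → 0 < m → InZ m y → Σ Word λ t → y ≡ O ∷ t
InZ-∷ {y = false ∷ t} _ _                   = t , refl
InZ-∷ {y = true ∷ _}  _ (refl , inj₁ () , _)
InZ-∷ {y = true ∷ _}  _ (_ , inj₂ () , _)
InZ-∷ {y = []}        () (refl , _)

InZ1-≡ : ∀ {y} → InZ 1 y → y ≡ O ∷ []
InZ1-≡ Zy with InZ-∷ (s≤s z≤n) Zy
InZ1-≡ (refl , _) | [] , refl = refl

shift-disjoint : ∀ a j m m' → PrefZ (0^ suc a 1^ j) m ⊥ PrefZ (0^ a 1^ suc j) m'
shift-disjoint a j m m' ((y , _ , refl) , (y' , _ , e)) =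
  ++-∷-≢ (replicate a O) _ _ (λ ()) (trans (sym (0^suc1^-++ a j y)) (trans e (0^1^suc-++ a j y')))

extend-disjoint : ∀ i j m {m'} → 0 < m' → PrefZ (0^ i 1^ suc j) m ⊥ PrefZ (0^ i 1^ j) m'
extend-disjoint i j m 0<m' ((y , _ , refl) , (y' , Zy' , e)) with InZ-∷ 0<m' Zy'
... | t , refl = ++-∷-≢ (0^ i 1^ j) _ _ (λ ()) (trans (sym (0^1^suc-++-∷ i j y)) e)

gray-InZ0 : GrayFromTo (InZ 0) ([] ∷ []) [] []
gray-InZ0 =
  record
    { complete = λ { [] _ → here refl ; (_ ∷ _) (() , _) }
    ; sound    = λ { _ (here refl) → refl , inj₁ refl , no-factor }
    ; unique   = Data.List.Relation.Unary.All.[] ∷ []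
    ; adjacent = [-]
    }
  , refl , refl
  where
    no-factor : OneDecreasing []
    no-factor []      (suc _) _ _ (() , _)
    no-factor (_ ∷ _) (suc _) _ _ (() , _)
    no-factor _       zero    _ _ (_ , () , _)

gray-InZ1 : ∀ L → IsGray (InZ 1) L → head L ≡ just (O ∷ []) → L ≡ (O ∷ []) ∷ []
gray-InZ1 (_ ∷ [])    _ refl = refl
gray-InZ1 (_ ∷ y ∷ _) g refl with IsGray.unique g
... | x∉ ∷ _ = ⊥-elim (lookup x∉ (here refl) (sym (InZ1-≡ (IsGray.sound g y (there (here refl))))))

∸-suc : ∀ m k → m ∸ k ∸ 1 ≡ m ∸ suc k
∸-suc m k = trans (∸-+-assoc m k 1) (cong (m ∸_) (+-comm k 1))

module Family (n : ℕ) (Z : ℕ → List Word) (Z0 : Z 0 ≡ [] ∷ [])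
              (good : ∀ k → 1 ≤ k → k < n → GoodZ k (Z k)) where

  good-∸ : ∀ {k} → 1 ≤ k → k < n → GoodZ (n ∸ k) (Z (n ∸ k))
  good-∸ {k} 1≤k k<n = good (n ∸ k) (m<n⇒0<n∸m k<n) (∸-monoʳ-< 1≤k (<⇒≤ k<n))

  gray-Z : ∀ m → m < n → Σ Word λ f → GrayFromTo (InZ m) (Z m) f (p001 m)
  gray-Z zero    _   rewrite Z0 = [] , gray-InZ0
  gray-Z (suc m) m<n = _ , good (suc m) (s≤s z≤n) m<n

  prefix-Z-empty : ∀ w {k} → k ≡ n → w · Z (n ∸ k) ≡ w ∷ []
  prefix-Z-empty w refl rewrite n∸n≡0 n | Z0 = cong [_] (++-identityʳ w)

  prefix-Z-single : ∀ w {k} → 1 ≤ k → suc k ≡ n → w · Z (n ∸ k) ≡ (w ++ O ∷ []) ∷ []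
  prefix-Z-single w {k} 1≤k refl rewrite m+n∸n≡m 1 k =
    let g , first , _ = good 1 (s≤s z≤n) (s≤s 1≤k) in cong (w ·_) (gray-InZ1 (Z 1) g first)

lemma3 : (n : ℕ) (Z : ℕ → List Word) →
    Z 0 ≡ ([] ∷ []) →
    (∀ k → 1 ≤ k → k < n → GoodZ k (Z k)) →
    ∀ i j → 1 ≤ j → j < i → i ≤ n →
    -- (i)
    ((3 ≤ i + j → i + j < n →
        IsGray (PrefZ (0^ i 1^ j) (n ∸ (i + j))) ((0^ i 1^ j) · Z (n ∸ (i + j)))
        × head ((0^ i 1^ j) · Z (n ∸ (i + j))) ≡ just (0^ i 1^ j ++ O ∷ p001 (n ∸ (i + j) ∸ 1))
        × last ((0^ i 1^ j) · Z (n ∸ (i + j))) ≡ just (0^ i 1^ j ++ p001 (n ∸ (i + j))))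
     × (i + j ≡ n → (0^ i 1^ j) · Z (n ∸ (i + j)) ≡ (0^ i 1^ j ∷ [])))
    -- (ii)
    × ((3 ≤ i + j → suc (i + j) < n →
        IsGray (PrefZ (0^ i 1^ suc j) (n ∸ suc (i + j)) ∪ PrefZ (0^ i 1^ j) (n ∸ (i + j)))
               ((0^ i 1^ suc j) · Z (n ∸ suc (i + j)) ++ (0^ i 1^ j) · Z (n ∸ (i + j)))
        × head ((0^ i 1^ suc j) · Z (n ∸ suc (i + j)) ++ (0^ i 1^ j) · Z (n ∸ (i + j)))
            ≡ just (0^ i 1^ suc j ++ O ∷ p001 (n ∸ suc (i + j) ∸ 1))
        × last ((0^ i 1^ suc j) · Z (n ∸ suc (i + j)) ++ (0^ i 1^ j) · Z (n ∸ (i + j)))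
            ≡ just (0^ i 1^ j ++ p001 (n ∸ (i + j))))
     × (suc (i + j) ≡ n →
        (0^ i 1^ suc j) · Z (n ∸ suc (i + j)) ++ (0^ i 1^ j) · Z (n ∸ (i + j))
          ≡ (0^ i 1^ suc j ∷ (0^ i 1^ j ++ O ∷ []) ∷ [])))
    -- (iii)
    × ((3 ≤ i + j → i + j < n →
        IsGray (PrefZ (0^ i 1^ j) (n ∸ (i + j)) ∪ PrefZ (0^ (i ∸ 1) 1^ suc j) (n ∸ (i + j)))
               ((0^ i 1^ j) · Z (n ∸ (i + j)) ++ reverse ((0^ (i ∸ 1) 1^ suc j) · Z (n ∸ (i + j))))
        × head ((0^ i 1^ j) · Z (n ∸ (i + j)) ++ reverse ((0^ (i ∸ 1) 1^ suc j) · Z (n ∸ (i + j))))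
            ≡ just (0^ i 1^ j ++ O ∷ p001 (n ∸ (i + j) ∸ 1))
        × last ((0^ i 1^ j) · Z (n ∸ (i + j)) ++ reverse ((0^ (i ∸ 1) 1^ suc j) · Z (n ∸ (i + j))))
            ≡ just (0^ (i ∸ 1) 1^ suc j ++ O ∷ p001 (n ∸ (i + j) ∸ 1)))
     × (i + j ≡ n →
        (0^ i 1^ j) · Z (n ∸ (i + j)) ++ reverse ((0^ (i ∸ 1) 1^ suc j) · Z (n ∸ (i + j)))
          ≡ (0^ i 1^ j ∷ 0^ (i ∸ 1) 1^ suc j ∷ [])))
    -- (iv)
    × (3 ≤ i + j → i + j ≤ n →
        IsGray (PrefZ (0^ i 1^ j) (n ∸ (i + j)) ∪ PrefZ (0^ (i ∸ 1) 1^ suc j) (n ∸ (i + j)))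
               (reverse ((0^ i 1^ j) · Z (n ∸ (i + j))) ++ (0^ (i ∸ 1) 1^ suc j) · Z (n ∸ (i + j)))
        × head (reverse ((0^ i 1^ j) · Z (n ∸ (i + j))) ++ (0^ (i ∸ 1) 1^ suc j) · Z (n ∸ (i + j)))
            ≡ just (0^ i 1^ j ++ p001 (n ∸ (i + j)))
        × last (reverse ((0^ i 1^ j) · Z (n ∸ (i + j))) ++ (0^ (i ∸ 1) 1^ suc j) · Z (n ∸ (i + j)))
            ≡ just (0^ (i ∸ 1) 1^ suc j ++ p001 (n ∸ (i + j))))
lemma3 n Z Z0 good zero    j _ () _
lemma3 n Z Z0 good (suc a) j _ _  _ =
    ( (λ _ k<n → prefix-gray w (good-∸ 1≤k k<n))
    , prefix-Z-empty w )
  , ( (λ _ k+1<n → ++-gray (prefix-gray w↑ (good-∸ (s≤s z≤n) k+1<n))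
                           (prefix-gray w (good-∸ 1≤k (<⇒≤ k+1<n)))
                           (extend-disjoint (suc a) j _ (m<n⇒0<n∸m (<⇒≤ k+1<n)))
                           extend-adjacent′)
    , λ k+1≡n → cong₂ _++_ (prefix-Z-empty w↑ k+1≡n) (prefix-Z-single w 1≤k k+1≡n) )
  , ( (λ _ k<n → let G = good-∸ 1≤k k<n in
                 ++-gray (prefix-gray w G) (reverse-gray (prefix-gray w↓ G))
                         (shift-disjoint a j _ _) (shift-adjacent a j _))
    , λ k≡n → cong₂ (λ L L' → L ++ reverse L') (prefix-Z-empty w k≡n) (prefix-Z-empty w↓ k≡n) )
  , λ _ k≤n → let f , G = gray-Z (n ∸ k) (∸-monoʳ-< 1≤k k≤n) in
              ++-gray (reverse-gray (prefix-gray w G)) (prefix-gray w↓ G)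
                      (shift-disjoint a j _ _) (shift-adjacent a j f)
  where
    open Family n Z Z0 good
    k : ℕ
    k = suc a + j
    1≤k : 1 ≤ k
    1≤k = s≤s z≤n
    w w↑ w↓ : Word
    w  = 0^ suc a 1^ j
    w↑ = 0^ suc a 1^ suc j
    w↓ = 0^ a 1^ suc j
    extend-adjacent′ : Adjacent (w↑ ++ p001 (n ∸ suc k)) (w ++ O ∷ p001 (n ∸ k ∸ 1))
    extend-adjacent′ rewrite ∸-suc n k = extend-adjacent (suc a) j _
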